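{- Let $l\in\{3,4\}$ and $2l+2\leq n\leq 14$, and let $k=\lceil n/2\rceil$. Set \[R=\binom{n}{l}-(n-l)\left\lceil\frac{n-l+1}{2}\right\rceil,\qquad L=\binom{n}{l}-\max\left\{3+C_l,\ (1+(l-1)(n-k))\left(\left\lceil\frac1k\binom{k}{l}\right\rceil-l+2\right)\right\}.\] Then every integer $m$ with $R<m<L$ belongs to $S(n,l-1)\cup S(n,l)$.
   Context: $S(n,j)$ is the set of sizes of maximal antichains $\mathcal A\subseteq\binom{[n]}{j}\cup\binom{[n]}{j+1}$ in the Boolean lattice $B_n$ (maximal: no subset of $[n]$ can be added keeping the antichain property); $\binom{[n]}{j}$ is the family of $j$-subsets of $[n]$. $C_l=\sum_{i=1}^l\frac{1}{i+1}\binom{2i}{i}$. (Here $R$ is the right end of the interval guaranteed in $S(n,l-1)$ and $L$ the left end of the interval guaranteed in $S(n,l)$ by the paper's main interval result.) -}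

module Defs where

open import Data.Nat using (ℕ; zero; suc; _+_; _*_; _∸_; _/_)
open import Data.Nat.Combinatorics using (_C_)
open import Data.Fin.Subset using (Subset; _⊆_; ∣_∣)
open import Data.List using (List; length)
open import Data.List.Membership.Propositional using (_∈_; _∉_)
open import Data.List.Relation.Unary.Unique.Propositional using (Unique)
open import Data.Product using (Σ; _×_)
open import Data.Sum using (_⊎_)
open import Relation.Binary.PropositionalEquality using (_≡_)

ceilDiv : ℕ → ℕ → ℕ
ceilDiv a zero = zero
ceilDiv a (suc b) = (a + b) / suc b

catalan : ℕ → ℕ
catalan i = ((2 * i) C i) / suc i

Csum : ℕ → ℕ
Csum zero = zero
Csum (suc l) = Csum l + catalan (suc l)

IsAntichain : {n : ℕ} → List (Subset n) → Set
IsAntichain {n} 𝒜 = (A B : Subset n) → A ∈ 𝒜 → B ∈ 𝒜 → A ⊆ B → A ≡ B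

IsMaximal : {n : ℕ} → List (Subset n) → Set
IsMaximal {n} 𝒜 = (X : Subset n) → X ∉ 𝒜 →
  Σ (Subset n) λ B → B ∈ 𝒜 × (X ⊆ B ⊎ B ⊆ X)

InLevels : {n : ℕ} → ℕ → List (Subset n) → Set
InLevels {n} j 𝒜 = (A : Subset n) → A ∈ 𝒜 → ∣ A ∣ ≡ j ⊎ ∣ A ∣ ≡ suc j

InS : ℕ → ℕ → ℕ → Set
InS n j m = Σ (List (Subset n)) λ 𝒜 →
  Unique 𝒜 × IsAntichain 𝒜 × IsMaximal 𝒜 × InLevels j 𝒜 × length 𝒜 ≡ m

-- For l ∈ {3, 4} and 2l + 2 ≤ n ≤ 14 the interval (R, L) is short, often empty, and every m in it
-- turns out to lie in S(n, l), witnessed by an explicit antichain F ∪ G with F ⊆ ([n] choose l) and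
-- G ⊆ ([n] choose l+1).  Such a family is a maximal antichain as soon as no member of F lies below a
-- member of G, every l-set outside F lies below a member of G and every (l+1)-set outside G lies above
-- a member of F: any other set X extends to an l-set (if |X| ≤ l) or shrinks to an (l+1)-set
-- (if |X| > l), and each of those is comparable with a member of the family.  These finitely many
-- conditions are decided by evaluation.
module Submission where

open import Defs
open import Data.Nat using (ℕ; _≤_; _∸_; _+_; _*_; ⌈_/2⌉)
open import Data.Nat.Combinatorics using (_C_)
open import Data.Integer using (ℤ; +_; _-_; _<_; _⊔_) renaming (_*_ to _ℤ*_; _+_ to _ℤ+_)
open import Data.Product using (_×_)
open import Data.Sum using (_⊎_)
open import Relation.Binary.PropositionalEquality using (_≡_)

open import Data.Bool using (Bool; true; false; T)
open import Data.Unit using (tt)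
open import Data.Empty using (⊥-elim)
open import Data.Fin.Subset using (Subset; inside; outside; ∣_∣; _⊆_)
open import Data.Fin.Subset.Properties using (s⊆s; out⊆; drop-∷-⊆; ⊆-trans; ∣p∣≤n; p⊆q⇒∣p∣≤∣q∣)
open import Data.Vec.Base using ([]; _∷_; here)
open import Data.Vec.Properties using (∷-injectiveʳ)
open import Data.Integer.Properties using (drop‿+<+)
open import Data.Bool.ListAction using (all; any)
open import Data.List using (List; []; _∷_; _++_; map; length; applyUpTo)
open import Data.List.Membership.Propositional using (_∈_; find)
open import Data.List.Membership.Propositional.Properties using (∈-++⁺ˡ; ∈-++⁺ʳ; ∈-++⁻; ∈-map⁺; ∈-map⁻; ∈-applyUpTo⁺)
open import Data.List.Relation.Unary.All as All using (All; []; _∷_)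
open import Data.List.Relation.Unary.All.Properties using (all⁺; map⁺; ++⁺)
open import Data.List.Relation.Unary.Any using (here; there)
open import Data.List.Relation.Unary.Any.Properties using (any⁻)
open import Data.List.Relation.Unary.Unique.Propositional using (Unique; []; _∷_)
import Data.List.Relation.Unary.Unique.Propositional.Properties as Unique
open import Data.Nat using (zero; suc; z≤n; s≤s; _/_; _%_; _≡ᵇ_; _≤?_; _<?_)
import Data.Nat.Properties as ℕ
open import Data.Product using (∃-syntax; _,_)
open import Data.Sum using (inj₁; inj₂)
open import Function using (id)
open import Relation.Binary.PropositionalEquality using (refl; sym; trans; cong; subst; subst₂)
open import Relation.Nullary using (¬_; Dec; yes; no; _because_; contradiction)
open import Relation.Nullary.Reflects using (fromEquivalence)
open import Relation.Nullary.Decidable using (True; isYes; isNo; toWitness; toWitnessFalse)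

infix 4 _⊆ᵇ_ _⊆?ᵇ_

-- Deciding inclusion with this Boolean test is several times faster under evaluation than `_⊆?_`,
-- which matters for the certificates below.
_⊆ᵇ_ : ∀ {n} → Subset n → Subset n → Bool
[]           ⊆ᵇ []            = true
(inside ∷ p) ⊆ᵇ (outside ∷ q) = false
(_ ∷ p)      ⊆ᵇ (_ ∷ q)       = p ⊆ᵇ q

⊆ᵇ⇒⊆ : ∀ {n} {p q : Subset n} → T (p ⊆ᵇ q) → p ⊆ q
⊆ᵇ⇒⊆ {p = []}          {[]}          _ = id
⊆ᵇ⇒⊆ {p = inside  ∷ p} {inside  ∷ q} t = s⊆s (⊆ᵇ⇒⊆ t)
⊆ᵇ⇒⊆ {p = outside ∷ p} {inside  ∷ q} t = out⊆ (⊆ᵇ⇒⊆ t)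
⊆ᵇ⇒⊆ {p = outside ∷ p} {outside ∷ q} t = s⊆s (⊆ᵇ⇒⊆ t)

⊆⇒⊆ᵇ : ∀ {n} {p q : Subset n} → p ⊆ q → T (p ⊆ᵇ q)
⊆⇒⊆ᵇ {p = []}          {[]}          _   = tt
⊆⇒⊆ᵇ {p = inside  ∷ p} {inside  ∷ q} p⊆q = ⊆⇒⊆ᵇ (drop-∷-⊆ p⊆q)
⊆⇒⊆ᵇ {p = inside  ∷ p} {outside ∷ q} p⊆q = contradiction (p⊆q here) λ ()
⊆⇒⊆ᵇ {p = outside ∷ p} {inside  ∷ q} p⊆q = ⊆⇒⊆ᵇ (drop-∷-⊆ p⊆q)
⊆⇒⊆ᵇ {p = outside ∷ p} {outside ∷ q} p⊆q = ⊆⇒⊆ᵇ (drop-∷-⊆ p⊆q)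

_⊆?ᵇ_ : ∀ {n} → (p q : Subset n) → Dec (p ⊆ q)
p ⊆?ᵇ q = (p ⊆ᵇ q) because fromEquivalence ⊆ᵇ⇒⊆ ⊆⇒⊆ᵇ

p⊆q⇒∣p∣≡∣q∣⇒p≡q : ∀ {n} {p q : Subset n} → p ⊆ q → ∣ p ∣ ≡ ∣ q ∣ → p ≡ q
p⊆q⇒∣p∣≡∣q∣⇒p≡q {p = []}          {[]}          _   _ = refl
p⊆q⇒∣p∣≡∣q∣⇒p≡q {p = inside  ∷ p} {inside  ∷ q} p⊆q e =
  cong (inside ∷_) (p⊆q⇒∣p∣≡∣q∣⇒p≡q (drop-∷-⊆ p⊆q) (ℕ.suc-injective e))
p⊆q⇒∣p∣≡∣q∣⇒p≡q {p = outside ∷ p} {outside ∷ q} p⊆q e =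
  cong (outside ∷_) (p⊆q⇒∣p∣≡∣q∣⇒p≡q (drop-∷-⊆ p⊆q) e)
p⊆q⇒∣p∣≡∣q∣⇒p≡q {p = inside  ∷ p} {outside ∷ q} p⊆q _ = contradiction (p⊆q here) λ ()
p⊆q⇒∣p∣≡∣q∣⇒p≡q {p = outside ∷ p} {inside  ∷ q} p⊆q e =
  contradiction (subst (_≤ ∣ q ∣) e (p⊆q⇒∣p∣≤∣q∣ (drop-∷-⊆ p⊆q))) (ℕ.n≮n ∣ q ∣)

superset-of-size : ∀ {n} (p : Subset n) {k} → ∣ p ∣ ≤ k → k ≤ n → ∃[ q ] p ⊆ q × ∣ q ∣ ≡ k
superset-of-size [] z≤n z≤n = [] , id , refl
superset-of-size (inside ∷ p) (s≤s ∣p∣≤k) (s≤s k≤n) =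
  let q , p⊆q , ∣q∣≡k = superset-of-size p ∣p∣≤k k≤n in inside ∷ q , s⊆s p⊆q , cong suc ∣q∣≡k
superset-of-size (outside ∷ p) {zero} ∣p∣≤0 _ =
  let q , p⊆q , ∣q∣≡0 = superset-of-size p ∣p∣≤0 z≤n in outside ∷ q , s⊆s p⊆q , ∣q∣≡0
superset-of-size (outside ∷ p) {suc k} ∣p∣≤1+k (s≤s k≤n) with ∣ p ∣ ≤? k
... | yes ∣p∣≤k =
  let q , p⊆q , ∣q∣≡k = superset-of-size p ∣p∣≤k k≤n in inside ∷ q , out⊆ p⊆q , cong suc ∣q∣≡k
... | no ∣p∣≰k =
  let q , p⊆q , ∣q∣≡1+k = superset-of-size p ∣p∣≤1+k (ℕ.≤-trans (ℕ.≰⇒> ∣p∣≰k) (∣p∣≤n p))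
  in outside ∷ q , s⊆s p⊆q , ∣q∣≡1+k

subset-of-size : ∀ {n} (p : Subset n) {k} → k ≤ ∣ p ∣ → ∃[ q ] q ⊆ p × ∣ q ∣ ≡ k
subset-of-size [] z≤n = [] , id , refl
subset-of-size (inside ∷ p) {zero} _ =
  let q , q⊆p , ∣q∣≡0 = subset-of-size p z≤n in outside ∷ q , out⊆ q⊆p , ∣q∣≡0
subset-of-size (inside ∷ p) {suc k} (s≤s k≤∣p∣) =
  let q , q⊆p , ∣q∣≡k = subset-of-size p k≤∣p∣ in inside ∷ q , s⊆s q⊆p , cong suc ∣q∣≡k
subset-of-size (outside ∷ p) k≤∣p∣ =
  let q , q⊆p , ∣q∣≡k = subset-of-size p k≤∣p∣ in outside ∷ q , s⊆s q⊆p , ∣q∣≡k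

subsetsOfSize : (n k : ℕ) → List (Subset n)
subsetsOfSize zero    zero    = [] ∷ []
subsetsOfSize zero    (suc k) = []
subsetsOfSize (suc n) zero    = map (outside ∷_) (subsetsOfSize n zero)
subsetsOfSize (suc n) (suc k) = map (inside ∷_) (subsetsOfSize n k) ++ map (outside ∷_) (subsetsOfSize n (suc k))

subsetsOfSize-∣∣ : ∀ n k → All (λ p → ∣ p ∣ ≡ k) (subsetsOfSize n k)
subsetsOfSize-∣∣ zero    zero    = refl ∷ []
subsetsOfSize-∣∣ zero    (suc k) = []
subsetsOfSize-∣∣ (suc n) zero    = map⁺ (subsetsOfSize-∣∣ n zero)
subsetsOfSize-∣∣ (suc n) (suc k) =
  ++⁺ (map⁺ (All.map (cong suc) (subsetsOfSize-∣∣ n k))) (map⁺ (subsetsOfSize-∣∣ n (suc k)))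

∈-subsetsOfSize : ∀ {n k} {p : Subset n} → ∣ p ∣ ≡ k → p ∈ subsetsOfSize n k
∈-subsetsOfSize {p = []}          refl = here refl
∈-subsetsOfSize {p = inside  ∷ p} refl = ∈-++⁺ˡ (∈-map⁺ (inside ∷_) (∈-subsetsOfSize refl))
∈-subsetsOfSize {suc n} {zero}  {outside ∷ p} ∣p∣≡0   = ∈-map⁺ (outside ∷_) (∈-subsetsOfSize ∣p∣≡0)
∈-subsetsOfSize {suc n} {suc k} {outside ∷ p} ∣p∣≡1+k =
  ∈-++⁺ʳ (map (inside ∷_) (subsetsOfSize n k)) (∈-map⁺ (outside ∷_) (∈-subsetsOfSize ∣p∣≡1+k))

subsetsOfSize-unique : ∀ n k → Unique (subsetsOfSize n k)
subsetsOfSize-unique zero    zero    = [] ∷ []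
subsetsOfSize-unique zero    (suc k) = []
subsetsOfSize-unique (suc n) zero    = Unique.map⁺ ∷-injectiveʳ (subsetsOfSize-unique n zero)
subsetsOfSize-unique (suc n) (suc k) =
  Unique.++⁺ (Unique.map⁺ ∷-injectiveʳ (subsetsOfSize-unique n k))
             (Unique.map⁺ ∷-injectiveʳ (subsetsOfSize-unique n (suc k)))
             inside≢outside
  where
  inside≢outside : ∀ {p} → ¬ (p ∈ map (inside ∷_) (subsetsOfSize n k) × p ∈ map (outside ∷_) (subsetsOfSize n (suc k)))
  inside≢outside (p∈ , p∈′) with ∈-map⁻ (inside ∷_) p∈ | ∈-map⁻ (outside ∷_) p∈′
  ... | _ , _ , refl | _ , _ , ()

isOdd : ℕ → Bool
isOdd mask = mask % 2 ≡ᵇ 1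

module _ {A : Set} where

  select reject : List A → ℕ → List A
  select []       _    = []
  select (x ∷ xs) mask with isOdd mask
  ... | true  = x ∷ select xs (mask / 2)
  ... | false = select xs (mask / 2)
  reject []       _    = []
  reject (x ∷ xs) mask with isOdd mask
  ... | true  = reject xs (mask / 2)
  ... | false = x ∷ reject xs (mask / 2)

  select-All : ∀ {P : A → Set} {xs} mask → All P xs → All P (select xs mask)
  select-All {xs = []}     _    []         = []
  select-All {xs = x ∷ xs} mask (px ∷ pxs) with isOdd mask
  ... | true  = px ∷ select-All (mask / 2) pxs
  ... | false = select-All (mask / 2) pxs

  select-Unique : ∀ {xs} mask → Unique xs → Unique (select xs mask)
  select-Unique {xs = []}     _    []         = []
  select-Unique {xs = x ∷ xs} mask (x∉ ∷ uxs) with isOdd mask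
  ... | true  = select-All (mask / 2) x∉ ∷ select-Unique (mask / 2) uxs
  ... | false = select-Unique (mask / 2) uxs

  ∈-select⊎reject : ∀ {x xs} mask → x ∈ xs → x ∈ select xs mask ⊎ x ∈ reject xs mask
  ∈-select⊎reject {xs = _ ∷ xs} mask x∈ with isOdd mask | x∈
  ... | true  | here refl = inj₁ (here refl)
  ... | false | here refl = inj₂ (here refl)
  ... | true  | there x∈xs with ∈-select⊎reject (mask / 2) x∈xs
  ...   | inj₁ s = inj₁ (there s)
  ...   | inj₂ r = inj₂ r
  ∈-select⊎reject mask x∈ | false | there x∈xs with ∈-select⊎reject (mask / 2) x∈xs
  ...   | inj₁ s = inj₁ s
  ...   | inj₂ r = inj₂ (there r)

module TwoLevelFamily {n j : ℕ} {F G : List (Subset n)}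
  (F-∣∣ : All (λ A → ∣ A ∣ ≡ j) F) (G-∣∣ : All (λ B → ∣ B ∣ ≡ suc j) G) where

  ++-levels : InLevels j (F ++ G)
  ++-levels A A∈ with ∈-++⁻ F A∈
  ... | inj₁ A∈F = inj₁ (All.lookup F-∣∣ A∈F)
  ... | inj₂ A∈G = inj₂ (All.lookup G-∣∣ A∈G)

  ++-unique : Unique F → Unique G → Unique (F ++ G)
  ++-unique uF uG = Unique.++⁺ uF uG λ (A∈F , A∈G) →
    ℕ.1+n≢n (trans (sym (All.lookup G-∣∣ A∈G)) (All.lookup F-∣∣ A∈F))

  ++-antichain : (∀ {A B} → A ∈ F → B ∈ G → ¬ A ⊆ B) → IsAntichain (F ++ G)
  ++-antichain F⊈G A B A∈ B∈ A⊆B with ∈-++⁻ F A∈ | ∈-++⁻ F B∈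
  ... | inj₁ A∈F | inj₁ B∈F = p⊆q⇒∣p∣≡∣q∣⇒p≡q A⊆B (trans (All.lookup F-∣∣ A∈F) (sym (All.lookup F-∣∣ B∈F)))
  ... | inj₂ A∈G | inj₂ B∈G = p⊆q⇒∣p∣≡∣q∣⇒p≡q A⊆B (trans (All.lookup G-∣∣ A∈G) (sym (All.lookup G-∣∣ B∈G)))
  ... | inj₁ A∈F | inj₂ B∈G = ⊥-elim (F⊈G A∈F B∈G A⊆B)
  ... | inj₂ A∈G | inj₁ B∈F =
    contradiction (subst₂ _≤_ (All.lookup G-∣∣ A∈G) (All.lookup F-∣∣ B∈F) (p⊆q⇒∣p∣≤∣q∣ A⊆B)) (ℕ.n≮n j)

  ++-maximal : suc j ≤ n →
               (∀ {A} → ∣ A ∣ ≡ j → A ∈ F ⊎ ∃[ B ] B ∈ G × A ⊆ B) →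
               (∀ {B} → ∣ B ∣ ≡ suc j → B ∈ G ⊎ ∃[ A ] A ∈ F × A ⊆ B) →
               IsMaximal (F ++ G)
  ++-maximal j<n lowerCovered upperCovered X _ with ∣ X ∣ ≤? j
  ... | yes ∣X∣≤j with superset-of-size X ∣X∣≤j (ℕ.<⇒≤ j<n)
  ...   | Y , X⊆Y , ∣Y∣≡j with lowerCovered ∣Y∣≡j
  ...     | inj₁ Y∈F             = Y , ∈-++⁺ˡ Y∈F , inj₁ X⊆Y
  ...     | inj₂ (B , B∈G , Y⊆B) = B , ∈-++⁺ʳ F B∈G , inj₁ (⊆-trans X⊆Y Y⊆B)
  ++-maximal j<n lowerCovered upperCovered X _ | no ∣X∣≰j with subset-of-size X (ℕ.≰⇒> ∣X∣≰j)
  ...   | Z , Z⊆X , ∣Z∣≡1+j with upperCovered ∣Z∣≡1+j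
  ...     | inj₁ Z∈G             = Z , ∈-++⁺ʳ F Z∈G , inj₂ Z⊆X
  ...     | inj₂ (A , A∈F , A⊆Z) = A , ∈-++⁺ˡ A∈F , inj₂ (⊆-trans A⊆Z Z⊆X)

module _ {n : ℕ} where

  noneBelowᵇ coveredAboveᵇ coveredBelowᵇ : List (Subset n) → List (Subset n) → Bool
  noneBelowᵇ    F G = all (λ A → all (λ B → isNo (A ⊆?ᵇ B)) G) F
  coveredAboveᵇ G 𝒳 = all (λ A → any (λ B → isYes (A ⊆?ᵇ B)) G) 𝒳
  coveredBelowᵇ F 𝒳 = all (λ B → any (λ A → isYes (A ⊆?ᵇ B)) F) 𝒳

  noneBelowᵇ-sound : ∀ {F G} → T (noneBelowᵇ F G) → ∀ {A B} → A ∈ F → B ∈ G → ¬ A ⊆ B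
  noneBelowᵇ-sound {F} {G} t {A} {B} A∈F B∈G =
    toWitnessFalse {a? = A ⊆?ᵇ B} (All.lookup (all⁺ _ G (All.lookup (all⁺ _ F t) A∈F)) B∈G)

  coveredAboveᵇ-sound : ∀ {G 𝒳} → T (coveredAboveᵇ G 𝒳) → ∀ {A} → A ∈ 𝒳 → ∃[ B ] B ∈ G × A ⊆ B
  coveredAboveᵇ-sound {G} t {A} A∈ =
    let B , B∈G , A⊆?B = find (any⁻ _ G (All.lookup (all⁺ _ _ t) A∈)) in B , B∈G , toWitness {a? = A ⊆?ᵇ B} A⊆?B

  coveredBelowᵇ-sound : ∀ {F 𝒳} → T (coveredBelowᵇ F 𝒳) → ∀ {B} → B ∈ 𝒳 → ∃[ A ] A ∈ F × A ⊆ B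
  coveredBelowᵇ-sound {F} t {B} B∈ =
    let A , A∈F , A⊆?B = find (any⁻ _ F (All.lookup (all⁺ _ _ t) B∈)) in A , A∈F , toWitness {a? = A ⊆?ᵇ B} A⊆?B

-- A candidate antichain is given by two bitmasks selecting F among the j-subsets and G among the
-- (j+1)-subsets, in the order of `subsetsOfSize`.  `Valid` normalises to a product of ⊤s exactly
-- when the checks succeed, so a certificate is accepted by the argument `_`.
module MaximalAntichainCertificate (n j lowerMask upperMask : ℕ) where

  lower upper F G : List (Subset n)
  lower = subsetsOfSize n j
  upper = subsetsOfSize n (suc j)
  F     = select lower lowerMask
  G     = select upper upperMask

  Valid : Set
  Valid = True (j <? n)
        × T (noneBelowᵇ F G)
        × T (coveredAboveᵇ G (reject lower lowerMask))
        × T (coveredBelowᵇ F (reject upper upperMask))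

  valid⇒InS : Valid → InS n j (length (F ++ G))
  valid⇒InS (j<n , noneBelow , coveredAbove , coveredBelow) =
    F ++ G , ++-unique (select-Unique lowerMask (subsetsOfSize-unique n j))
                       (select-Unique upperMask (subsetsOfSize-unique n (suc j)))
           , ++-antichain (noneBelowᵇ-sound noneBelow)
           , ++-maximal (toWitness j<n) lowerCovered upperCovered
           , ++-levels , refl
    where
    open TwoLevelFamily (select-All lowerMask (subsetsOfSize-∣∣ n j)) (select-All upperMask (subsetsOfSize-∣∣ n (suc j)))

    lowerCovered : ∀ {A} → ∣ A ∣ ≡ j → A ∈ F ⊎ ∃[ B ] B ∈ G × A ⊆ B
    lowerCovered ∣A∣≡j with ∈-select⊎reject lowerMask (∈-subsetsOfSize ∣A∣≡j)
    ... | inj₁ A∈F    = inj₁ A∈F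
    ... | inj₂ A∈rest = inj₂ (coveredAboveᵇ-sound coveredAbove A∈rest)

    upperCovered : ∀ {B} → ∣ B ∣ ≡ suc j → B ∈ G ⊎ ∃[ A ] A ∈ F × A ⊆ B
    upperCovered ∣B∣≡1+j with ∈-select⊎reject upperMask (∈-subsetsOfSize ∣B∣≡1+j)
    ... | inj₁ B∈G    = inj₁ B∈G
    ... | inj₂ B∈rest = inj₂ (coveredBelowᵇ-sound coveredBelow B∈rest)

open MaximalAntichainCertificate using () renaming (valid⇒InS to certified)

interval : ℕ → ℕ → List ℕ
interval lo hi = applyUpTo (_+_ lo) (hi ∸ lo)

∈-interval : ∀ {lo hi m} → lo ≤ m → suc m ≤ hi → m ∈ interval lo hi
∈-interval {lo} {hi} {m} lo≤m m<hi =
  subst (_∈ interval lo hi) (ℕ.m+[n∸m]≡n lo≤m) (∈-applyUpTo⁺ (_+_ lo) (ℕ.∸-monoˡ-< m<hi lo≤m))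

-- The theorem for fixed l and n; once l and n are numerals both bounds normalise to integer literals.
Realised : ℕ → ℕ → Set
Realised l n = (m : ℕ) →
    (+ (n C l) - + ((n ∸ l) * ceilDiv (n ∸ l + 1) 2)) < + m →
    + m < (+ (n C l) - ((+ (3 + Csum l)) ⊔ ((+ (1 + (l ∸ 1) * (n ∸ ⌈ n /2⌉))) ℤ* (((+ (ceilDiv (⌈ n /2⌉ C l) ⌈ n /2⌉)) - (+ l)) ℤ+ (+ 2))))) →
    InS n (l ∸ 1) m ⊎ InS n l m

lookupBetween : ∀ {P : ℕ → Set} r hi → All P (interval (suc r) hi) → ∀ m → + r < + m → + m < + hi → P m
lookupBetween r hi table m r<m m<hi = All.lookup table (∈-interval (drop‿+<+ r<m) (drop‿+<+ m<hi))

realised-3-8 : Realised 3 8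
realised-3-8 = lookupBetween 41 45
  ( inj₂ (certified 8 3 1746535597473791 740176837685496774656 _)
  ∷ inj₂ (certified 8 3 70985637638813695 504438377131540480 _)
  ∷ inj₂ (certified 8 3 1747087536422911 740176767041874690048 _)
  ∷ [])

realised-3-9 : Realised 3 9
realised-3-9 = lookupBetween 60 73
  ( inj₂ (certified 9 3 10747420405599593225715677 5354556764081026235268630625387008 _)
  ∷ inj₂ (certified 9 3 16918720224070643458575412 332631517499887418011169553075274785 _)
  ∷ inj₂ (certified 9 3 18112007073243134158050920 157160660921190141491417346 _)
  ∷ inj₂ (certified 9 3 19320932892875355518801512 2418156010517607129026818 _)
  ∷ inj₂ (certified 9 3 19323294076116790374962792 2418156010508811036004610 _)
  ∷ inj₂ (certified 9 3 7129426776258468414095237 10384595270539333461859482156696576 _)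
  ∷ inj₂ (certified 9 3 6808305855423332405280645 5327296578410202825113151704670176768 _)
  ∷ inj₂ (certified 9 3 7129426776258468279811973 10384595270539333497923463548798464 _)
  ∷ inj₂ (certified 9 3 15280397346740086297591795 5316911983454135320446987254819194880 _)
  ∷ inj₂ (certified 9 3 18586976222079327914090461 19375869682029178956808704 _)
  ∷ inj₂ (certified 9 3 7206331252301763539107727 1553469678204798489498222592 _)
  ∷ inj₂ (certified 9 3 16489323166354715518435315 5316911983454135320442483655191824384 _)
  ∷ [])

realised-3-10 : Realised 3 10
realised-3-10 = lookupBetween 92 109
  ( inj₂ (certified 10 3 733422964880925177253212912519746815 22999398886086756782258958322258273804728854289183924480376832 _)
  ∷ inj₂ (certified 10 3 903247625058160991239520917394429183 401734558956706586578293867993350236957179310966717221437440 _)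
  ∷ inj₂ (certified 10 3 902598587950825174533046831864878335 401734558980090615563181464500937086972623089809580483411968 _)
  ∷ inj₂ (certified 10 3 986324374794718233296008868325627135 401734558956706586578293867993350235748253491352088046731264 _)
  ∷ inj₂ (certified 10 3 68798825474180109996847160642770175 871462687978891107180937974036757726109605023328972953077415936 _)
  ∷ inj₂ (certified 10 3 1325266525179980883399709539203703936 100435926557044097627310728965853218235943721034401160692123 _)
  ∷ inj₂ (certified 10 3 664285817004101689910132335477522431 25108502722524104126806695987276545180541713330150567837696 _)
  ∷ inj₂ (certified 10 3 664285817004101689910133503708626943 25108502722524104126806695987276390438036802657616205447168 _)
  ∷ inj₂ (certified 10 3 653733893407801906066230768782278655 427241654189839412362466885987974173932793386703705903988736 _)
  ∷ inj₂ (certified 10 3 664285817313596162911188385433387007 25108502722524092976434096721964819670177666333435452456960 _)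
  ∷ inj₂ (certified 10 3 1326307203767400874523594302670494719 98079714618271385042605064946472234634125976208874143744 _)
  ∷ inj₂ (certified 10 3 664285817313899021555390548851818495 25108502722523736164510920231994555098685303959651356770304 _)
  ∷ inj₂ (certified 10 3 82568520107356340343547039345508351 822780537878376588068032719197855904192716530228816457356017664 _)
  ∷ inj₂ (certified 10 3 1326631722321059301250377475912883199 98079714618271385042605064946472229911759493339228930048 _)
  ∷ inj₂ (certified 10 3 1329065578046916037972615183614598300 5708990770823839524233146241287065131334762497 _)
  ∷ inj₂ (certified 10 3 1329065578051751888825026289989835932 2363489084585803776001 _)
  ∷ [])

realised-3-11 : Realised 3 11
realised-3-11 = lookupBetween 125 132
  ( inj₂ (certified 11 3 33591112153604521887821592507586649976540489471655 2135987099578284342847713905667796293124774120590740581318111254416767033519185737107531014078464 _)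
  ∷ inj₂ (certified 11 3 46490772899135408967705383745313869279918384472912 260740608871329107846970263506240696044204134986564901109044119954475162534013482468894711812 _)
  ∷ inj₂ (certified 11 3 33591022950623727764061375764485325407624542180007 2135987226893032863753097834590654548874850246619894602420456100606549541483761227770336892682240 _)
  ∷ inj₂ (certified 11 3 33591157456076594806201110318297253066125485168375 2135987035920910082395021942770044071944473165666850445816969810511638441999939996926037471526912 _)
  ∷ inj₂ (certified 11 3 46490772899135408967706002715333511970055867594576 260740608871329107846970263506240696044204134986564901109044119954475162534013464876708667396 _)
  ∷ inj₂ (certified 11 3 15764097906798949868777784982468804166415281944422 10682315243340074583698514681457709342158073085222679997609574058810982080917891473593997484621828 _)
  ∷ [])

realised-3-12 : Realised 3 12
realised-3-12 = lookupBetween 175 181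
  ( inj₂ (certified 12 3 1262589599253905967252509250596159091700878020547362745620473052470 1714827694875749858235024784106557965584983584590755977921123457905148110200943500845235130486020620782559370782433494484986993562617871597824 _)
  ∷ inj₂ (certified 12 3 1262615310262614111102626912760460389826751519673061255249415372086 1714827694875749815927442781530647632662403870493409428903223748191150075983420603283264491362093774346603549660714735096164699213554748752128 _)
  ∷ inj₂ (certified 12 3 5326992554908713798066356186732976018914289782348550516997357567 76819988326175939669052111410464653278219176800253045711083312017577558185114317054321304323370987735870849626368710089524783208127509364655167373312 _)
  ∷ inj₂ (certified 12 3 1262589574145499025340053973995769951353241660593604032005975760182 1762461797511186751420561241529868610169796932657374836748228268114639396611449237138716747677008152159560269929700284162719686468508940501248 _)
  ∷ inj₂ (certified 12 3 1263535330815978365878443600364709775698161051784180353198091402943 744282853678701786450511675404714316395074449474505780444215641406661958455950224265553323107210628167318226997394873290247031823083241472 _)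
  ∷ [])

realised-3-13 : Realised 3 13
realised-3-13 = lookupBetween 226 234
  ( inj₂ (certified 13 3 108497249983652740995325819890278656739171196642760156137783312048166181906348624493382 10915809366006164479632241823182811853014679429122259887241820582638074097349028345228943048623267325539563868663150859568621195611061698265530100791961549555613699426128191353830406478408140221526199410622472 _)
  ∷ inj₂ (certified 13 3 15241309065987548854610458537730560117593768719360696897880113988670207076758279821892 12204412857961235893887426917864883680169959949638220413651905349429897537877792639505082968897697919203892033206203461884452156700175903229034758043074922326719938089453595509825286430213695324240114360527000 _)
  ∷ inj₂ (certified 13 3 108497249983652740995326231266417987040681757861386695337236946414952160384468364737350 10915809366006164479632241823182811853014679429122259887241820582638074097349027998645231283521409878237790850777687930013986773633989801955582523964298073852410819423752242036750488519122840477917630412357640 _)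
  ∷ inj₂ (certified 13 3 120190650786359989147257469314624679202444572424980624756629456299275869197272897980678 10520271803096747014481988467925131641014756922558258062246975546964835654092602515769423882214888433880173955519573857139354211694517050225096239655523090970777796929241596352486794323594407096720527349403090988 _)
  ∷ inj₂ (certified 13 3 108497249983653182707092425862500382865056949863100239294948923876612454968370361449286 10915809366006164479632241823182811853014679429122259887241820582638073725207601159294503322267620239579469261713311258107139909511007821468267009904561330842592853976806674926339426110839738508201596561653768 _)
  ∷ inj₂ (certified 13 3 120190650786359989154102768273080896525246829222996537858767160777059903496942495116046 10520271803096747014481988467925131641014756922558258062246975546964835654092596837341890322785898409263139252567300103155823267566950550541654804492022064733914810797328951999509574317682989742796469541810470952 _)
  ∷ inj₂ (certified 13 3 120190650786359989154102768273080896338174619644640964328695502189375676980708241214222 10520271803096747014481988467925131641014756922558258062246975546964835654092596837341890322786056017287924830484149219316223842022170869498736666278693857907531793684414940841955559704207993257587910643256655912 _)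
  ∷ [])

realised-3-14 : Realised 3 14
realised-3-14 = lookupBetween 298 304
  ( inj₂ (certified 14 3 18114590916857716709207148689673345290875350254841437397107742315562615839242612884186754114015957403773173759 337257096723341205234700948901345019283660105894135371120626362506382229877801007712092278553100356251588070452946300362359968454172250367752530722667059350317104049277396681817927058322831643390867343517962169374506224965271411624926959511747951373879009237932985539541208736167202083321914851328 _)
  ∷ inj₂ (certified 14 3 22116661115671575168984434129114687808906346290193493284067764231722267932254686849819508339599592005031159791 735756550908426791779795355727761531120998013431385991594105755743947933924119936550082888103137882326037945049784323269911410837878486497754326872572126993814049478469291966059145259794261897764040534719167744964761978228592106275974566560863149706113052958689555483085568350719715818059350409216 _)
  ∷ inj₂ (certified 14 3 37132868044209224143079796852169904318739359152984555435632752311678593075750147325514028256968098847226984295 39916806488097920295624400810974143956518769082748349352202345722429024800811234893010555497927195319251013095761932442287310784654011918743301991717201259068329707220367066938180900690499092020518952012780965373193891195592648365863801310693104690700364601990112998438501205513938322277269504 _)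
  ∷ inj₂ (certified 14 3 22116661115671575168984558459923790255566885135755529989470859558057928868290426546954883481502472451032344559 735756550908426791779795355727761531120998013431385991594105755743947933924119936550082888103137882326037945049784323237493320455995729009376140437484930501529313289075253684843072371586036808600695640971456425065513585352046117125186739697261701627948019623527706503943981361587824584019220103168 _)
  ∷ inj₂ (certified 14 3 22116661115688663073420116269974308191787726373395628034309345772645387455046076145676487538658847897465382895 735756550908426789510510643353030901124240999139863456556836957398026866152880541060082922079748386122647133150690653535568134781313708599462335333870668870253875146104199804794093200561449463243213316396682982363481732005315609201339693656738667033837036656652851391018919578353138807203398942720 _)
  ∷ [])

realised-4-10 : Realised 4 10
realised-4-10 = lookupBetween 186 185 []

realised-4-11 : Realised 4 11
realised-4-11 = lookupBetween 302 305
  ( inj₂ (certified 11 4 1913825219732393415360664855161427166452672860837652504898086994097224544722724528632875105109671935 23259548981578036738400937688755508621689756934089361971829743862672215285886788355420432388952718333543497775679872681144518317044662272 _)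
  ∷ inj₂ (certified 11 4 1913825150491446883607196479826902519852376226534435331241552860632211006925426402349939434423582719 23258839177459420497741202956149681657936020512408052708003188727134871827000090490137852129772694313877536648574592655670874173612228608 _)
  ∷ [])

realised-4-12 : Realised 4 12
realised-4-12 = lookupBetween 455 470
  ( inj₂ (certified 12 4 95434519659455201700691711997178925705872627128568879731521004051397225747236605889900118170875363865774592323017919244239378289458283549475483942911 841253714027140687265564578886324116280834062015408450231372735360439220291971942925811940294831772231055114353185016104466319735409753861239190174986099723248229150251111141925485791950509942402188648236437149387797553759676363352047616 _)
  ∷ inj₂ (certified 12 4 102293450399589290412471638597175300502175256357271023964587208776140996321961744404315105972790964658391107203492957187102324189551319314091298783159 16996415770167463458250960676436558889674825884588202460048786643371893992737640503428710426973922280622990715964965834741411562172291947650989938047321246866380346687304793537875279872 _)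
  ∷ inj₂ (certified 12 4 102293017497887405288377044629919257595039688668074400710570938096824720086542576449233803266491530685575151603678520229695583670988165966377848406015 361475337991850857109852100123307495996575031251977294945743903948601791967269214645770908280657399005607318371357010307367020521837006796126478377223619881751685010390895828576725886246528125539729567627573706955650236416 _)
  ∷ inj₂ (certified 12 4 102212290939176104327432720968675257052753552803262772966823151200049682147786152552340676266409406221482966804046316861289954438962792151935145213915 11567161174868858867503549817670155728287145622944061541103214309911961554844300020322035229148180093622111708550478062494218964476736423255125844532233212164599349027235531036732637405004602940727474986799722552669694459904 _)
  ∷ inj₂ (certified 12 4 102290322500282515962655230294714316745370237847280629550333394235839046012213724709549193297985093311834920249685121104629405074258189233601382449151 379038520958690201799790235088194577339013359861468327214157528442565025273964623517040988584460797550862674251131314480674858368590596697420152163362851421583674963322758798169162160012174274026200017430293965032604902256279552 _)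
  ∷ inj₂ (certified 12 4 102293017500864539545164932855385794444385319430702183112026583790555187760102122590227328577070798645992492625149225429836384646585128680966821249023 1551277199017500366168321115129487601730534975371786268456798176981681035806657819046393267959393332391587576658745367238523004572754830279581897290780128543110681108165143428980967462073991088625614282887068836167680 _)
  ∷ inj₂ (certified 12 4 102293261387470038688045717579571805356072240199859268796852098663085586059605029049113779363524830982150322969872892077703310050127591539365307702591 689456532887748412341091025928864225488393030855887744429033201673124748480281722621234073541182902020725454397437243118273252570047860491477615663085376083203477687933724710215923437462633328659079011791866303610880 _)
  ∷ inj₂ (certified 12 4 102212290939176104327779304680440358910200854576280658429752705834471659219682462499917503929885109424362963610254024174120582721912156390012963782619 11567161174868858867503549817670155728287145622944061541103214309911961554844300020322035229148180093622111708550478062494218964476736423255125837121539500976362841918692490480706534795725584339731376461514346046229397504000 _)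
  ∷ inj₂ (certified 12 4 102293017500864539567346290408352313321012632912806105648566654092509556645273552592689578825309394010629989985923712739015989482950407673572692590591 1551277199017500366168321115129487535338285873275898932258272357923102619607518103167402868028876057341142594052215024843210221419094121668415711509967501624788263901576738502790970116250572095646705428462916457201664 _)
  ∷ inj₂ (certified 12 4 102290322506236778793471176789195133733514301344984534155325922611173753052793848063477017564818606561889491846341980730969799509599939677209602555903 379038520958690201799790230189311266681670922913617925812517923920333242651889165284720084888459587093715462290977640580845892538311076324738078458415127746344071092371179553818727976415634296195733192386103013531796880243032064 _)
  ∷ inj₂ (certified 12 4 102293261387470038688045717579571805357274694002239471409531512728641726617621379376873553503915033244371488769427946541747206275783283602356035345727 689456532887748412341091025928864225488393030855887744429033201673124748480281722621234073498875320018149544064514663404175906021029960781763617628867853185641507048809798577403813969320855098413241442190371372138496 _)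
  ∷ inj₂ (certified 12 4 102262238915981160203481410236117049571092832146563297968166452345825665167503578749839428827534125296644135656263036430700049308002215440727012278235 11567161174868858867503549817670155728287145622944061541103214309911961554844300020322035229148180093622111708550478062494218963408742905294670795924028647891586784617340229302380149822204780428621513571194071034748354035712 _)
  ∷ inj₂ (certified 12 4 102290322506236778793471176789840696203036028492398513948326675579756179501001153948438655859478658667418773154806037216991473327951944019317155168255 379038520958690201799790230189311266681670922913617925812517923920333242651889165284720084888436873383581224575647974211849392396612525032216599769031331177619676114617635868714784506080829184771959363585907195471373923942137856 _)
  ∷ inj₂ (certified 12 4 102293261387470038688045717579571805376513954840322713212402137777539975545882970817530509884749160883163345103166829295200499718215346628944251018559 689456532887748412341091025928864225488393030855887744429033201673124748480281722621234073498875320018149544064514663404175906021029960781763617628867852774265367718508288038661518329983228852729275033795405534986240 _)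
  ∷ [])

realised-4-13 : Realised 4 13
realised-4-13 = lookupBetween 670 658 []

realised-4-14 : Realised 4 14
realised-4-14 = lookupBetween 941 935 []

realised-3 : All (Realised 3) (interval 8 15)
realised-3 = realised-3-8 ∷ realised-3-9 ∷ realised-3-10 ∷ realised-3-11 ∷ realised-3-12 ∷ realised-3-13 ∷ realised-3-14 ∷ []

realised-4 : All (Realised 4) (interval 10 15)
realised-4 = realised-4-10 ∷ realised-4-11 ∷ realised-4-12 ∷ realised-4-13 ∷ realised-4-14 ∷ []

lemma4p5 : (l n : ℕ) → (l ≡ 3 ⊎ l ≡ 4) → 2 * l + 2 ≤ n → n ≤ 14 →
    (m : ℕ) →
    (+ (n C l) - + ((n ∸ l) * ceilDiv (n ∸ l + 1) 2)) < + m →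
    + m < (+ (n C l) - ((+ (3 + Csum l)) ⊔ ((+ (1 + (l ∸ 1) * (n ∸ ⌈ n /2⌉))) ℤ* (((+ (ceilDiv (⌈ n /2⌉ C l) ⌈ n /2⌉)) - (+ l)) ℤ+ (+ 2))))) →
    InS n (l ∸ 1) m ⊎ InS n l m
lemma4p5 .3 n (inj₁ refl) 8≤n  n≤14 = All.lookup realised-3 (∈-interval 8≤n (s≤s n≤14))
lemma4p5 .4 n (inj₂ refl) 10≤n n≤14 = All.lookup realised-4 (∈-interval 10≤n (s≤s n≤14))
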